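{- Let $t\ge 3$ and let $n_1,\dots,n_t$ be integers with $n_i\ge t+1$ for all $i$. Let $G=K_{n_1}\times K_{n_2}\times\cdots\times K_{n_t}$ (iterated direct product). Then $\gamma_{\mathrm{pr}}(G)=t+1$ if $t$ is odd and $\gamma_{\mathrm{pr}}(G)=t+2$ if $t$ is even.
   Context: $K_n$ is the complete graph on $n$ vertices. The direct product $G\times H$ has vertex set $V(G)\times V(H)$, with $(u_G,u_H)$ adjacent to $(v_G,v_H)$ iff $u_Gv_G\in E(G)$ and $u_Hv_H\in E(H)$; thus in $\times_{i=1}^t K_{n_i}$, with $V(K_{n_i})=\{0,\dots,n_i-1\}$, the vertices $(a_1,\dots,a_t)$ and $(b_1,\dots,b_t)$ are adjacent iff $a_i\ne b_i$ for all $i$. A set $D$ is dominating if every vertex is in $D$ or adjacent to a vertex of $D$. For a graph without isolated vertices, $\gamma_{\mathrm{pr}}$ is the minimum size of a dominating set whose induced subgraph has a perfect matching. -}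

module Defs where

open import Data.Nat using (ℕ; _*_; _≤_)
open import Data.Fin using (Fin)
open import Data.List using (List; length; concatMap; _∷_; [])
open import Data.List.Membership.Propositional using (_∈_)
open import Data.List.Relation.Unary.All using (All)
open import Data.List.Relation.Unary.Unique.Propositional using (Unique)
open import Data.Product using (_×_; _,_; ∃-syntax; Σ)
open import Data.Sum using (_⊎_)
open import Relation.Binary.PropositionalEquality using (_≡_; _≢_)
open import Level using (0ℓ)

record Graph : Set₁ where
  field
    V   : Set
    Adj : V → V → Set
open Graph public

-- Direct product of complete graphs K_{n 0} × … × K_{n (t-1)}:
-- vertices are tuples a with a i ∈ {0,…,n i - 1}; adjacent iff they differ in every coordinate.
ProdK : (t : ℕ) → (Fin t → ℕ) → Graph
ProdK t n = record
  { V   = (i : Fin t) → Fin (n i)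
  ; Adj = λ a b → (i : Fin t) → a i ≢ b i }

-- A paired set is given with its perfect matching: a list of pairs (u , w)
-- with u adjacent to w, such that all the listed vertices are pairwise distinct.
vertices : {G : Graph} → List (V G × V G) → List (V G)
vertices = concatMap (λ { (u , w) → u ∷ w ∷ [] })

record PairedDominating (G : Graph) (M : List (V G × V G)) : Set where
  field
    edges      : All (λ p → Adj G (Data.Product.proj₁ p) (Data.Product.proj₂ p)) M
    distinct   : Unique (vertices {G} M)
    dominating : (v : V G) → ∃[ d ] (d ∈ vertices {G} M × (v ≡ d ⊎ Adj G v d))

PairedDomNumber : (G : Graph) → ℕ → Set
PairedDomNumber G k =
  (∃[ M ] (PairedDominating G M × length (vertices {G} M) ≡ k))
  × (∀ M → PairedDominating G M → k ≤ length (vertices {G} M))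

module Submission where

-- The t + 1 constant vertices c_y = (y, …, y), y ≤ t, are pairwise adjacent, and a
-- vertex has only t coordinates, so it misses some value y ≤ t everywhere and is
-- adjacent to c_y.  Pairing the constants up (together with one non-constant
-- neighbour of c_0 when t is even) gives the upper bounds.  Conversely, if
-- e_0, …, e_{t-1} dominated, the diagonal (e_i(i))_i is adjacent to no e_k, so it is
-- some e_j; changing its j-th coordinate to a value unused there by every e_k
-- yields a vertex equal to no e_k, and sharing coordinate k with e_k (for k = j, a
-- second coordinate with e_j).  Hence dominating sets have more than t vertices,
-- and a paired dominating set has even size.

open import Defs
import Data.Nat as Nat
open import Data.Nat using (ℕ; suc; _≤_; _<_; _+_; _%_; s≤s; z≤n; _<?_)
open import Data.Nat.Properties using (+-comm; ≤∧≢⇒<; ≰⇒>; ≤-pred; ≤-trans; n≤1+n; n≮n)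
open import Data.Fin as Fin using (Fin; toℕ; inject≤; fromℕ<; punchIn)
open import Data.Fin.Properties
  using (_≟_; any?; ¬∀⟶∃¬; injective⇒≤; toℕ-injective; toℕ-inject≤; inject≤-injective; punchInᵢ≢i)
open import Data.List using (List; []; _∷_; length; map; allFin)
open import Data.List.Properties using (length-map; length-tabulate)
open import Data.List.Membership.Propositional using (_∈_)
open import Data.List.Membership.Propositional.Properties using (∈-map⁺; ∈-allFin)
open import Data.List.Relation.Unary.Any using (here; there)
open import Data.List.Relation.Unary.All using (All; []; _∷_)
import Data.List.Relation.Unary.All.Properties as Allₚ
open import Data.List.Relation.Unary.AllPairs as AllPairs using (AllPairs; []; _∷_)
import Data.List.Relation.Unary.AllPairs.Properties as AllPairsₚ
open import Data.List.Relation.Unary.Unique.Propositional using (Unique)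
import Data.List.Relation.Unary.Unique.Propositional.Properties as Uniqueₚ
open import Data.Product using (Σ; ∃-syntax; _×_; _,_; proj₁; proj₂)
open import Data.Sum using (_⊎_; inj₁; inj₂)
open import Function using (_∘_)
open import Relation.Nullary using (¬_; yes; no; contradiction)
open import Relation.Binary.PropositionalEquality
  using (_≡_; _≢_; refl; sym; trans; cong; cong-app; subst; module ≡-Reasoning)

private
  variable
    A : Set
    t : ℕ
    n : Fin t → ℕ

odd⇒suc-even : ∀ m → m % 2 ≡ 1 → suc m % 2 ≡ 0
odd⇒suc-even 1 _ = refl
odd⇒suc-even (suc (suc m)) = odd⇒suc-even m

even⇒suc-odd : ∀ m → m % 2 ≡ 0 → suc m % 2 ≡ 1
even⇒suc-odd 0 _ = refl
even⇒suc-odd (suc (suc m)) = even⇒suc-odd m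

even<even⇒1+m<n : ∀ {m n} → m % 2 ≡ 0 → n % 2 ≡ 0 → m < n → suc m < n
even<even⇒1+m<n {m} m-even n-even m<n =
  ≤∧≢⇒< m<n λ { refl → contradiction (trans (sym (even⇒suc-odd m m-even)) n-even) λ () }

missing-value : (h : Fin t → ℕ) → ∃[ y ] ∀ k → h k ≢ toℕ {suc t} y
missing-value {t} h =
  let y , y-missed = ¬∀⟶∃¬ (suc t) (λ y → ∃[ k ] h k ≡ toℕ y)
                       (λ y → any? λ k → h k Nat.≟ toℕ y) all-hit
  in y , λ k eq → y-missed (k , eq)
  where
  all-hit : ¬ (∀ y → ∃[ k ] h k ≡ toℕ y)
  all-hit hit = n≮n t (injective⇒≤ {f = proj₁ ∘ hit} hit-injective)
    where
    hit-injective : ∀ {y y′} → proj₁ (hit y) ≡ proj₁ (hit y′) → y ≡ y′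
    hit-injective {y} {y′} eq =
      toℕ-injective (trans (sym (proj₂ (hit y))) (trans (cong h eq) (proj₂ (hit y′))))

padded-enumeration : A → (D : List A) → length D ≤ t →
  Σ (Fin t → A) λ e → ∀ {x} → x ∈ D → ∃[ i ] e i ≡ x
padded-enumeration x₀ [] _ = (λ _ → x₀) , λ ()
padded-enumeration {t = suc t} x₀ (x ∷ D) (s≤s |D|≤t) =
  let e , covers = padded-enumeration x₀ D |D|≤t in
  (λ { Fin.zero → x ; (Fin.suc i) → e i }) ,
  λ { (here refl) → Fin.zero , refl
    ; (there x∈D) → let i , eᵢ≡x = covers x∈D in Fin.suc i , eᵢ≡x }

other-index : 2 ≤ t → (j : Fin t) → ∃[ i ] i ≢ j
other-index (s≤s (s≤s _)) j = punchIn j Fin.zero , punchInᵢ≢i j Fin.zero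

Dominates : (G : Graph) → (V G → Set) → Set
Dominates G D = ∀ v → ∃[ d ] (D d × (v ≡ d ⊎ Adj G v d))

pairUp : List A → List (A × A)
pairUp [] = []
pairUp (x ∷ []) = []
pairUp (x ∷ y ∷ xs) = (x , y) ∷ pairUp xs

vertices-pairUp : {G : Graph} (xs : List (V G)) → length xs % 2 ≡ 0 →
  vertices {G} (pairUp xs) ≡ xs
vertices-pairUp [] _ = refl
vertices-pairUp {G} (x ∷ y ∷ xs) even = cong (λ zs → x ∷ y ∷ zs) (vertices-pairUp {G} xs even)

pairUp⁺ : {R : A → A → Set} {xs : List A} →
  AllPairs R xs → All (λ p → R (proj₁ p) (proj₂ p)) (pairUp xs)
pairUp⁺ [] = []
pairUp⁺ (_ ∷ []) = []
pairUp⁺ ((Rxy ∷ _) ∷ _ ∷ pairs) = Rxy ∷ pairUp⁺ pairs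

pairUp-pairedDominating : {G : Graph} (xs : List (V G)) → length xs % 2 ≡ 0 → Unique xs →
  All (λ p → Adj G (proj₁ p) (proj₂ p)) (pairUp xs) → Dominates G (_∈ xs) →
  PairedDominating G (pairUp xs)
pairUp-pairedDominating {G} xs even unique edges dom = record
  { edges = edges
  ; distinct = subst Unique (sym vertices≡xs) unique
  ; dominating = subst (λ ys → Dominates G (_∈ ys)) (sym vertices≡xs) dom
  }
  where
  vertices≡xs : vertices {G} (pairUp xs) ≡ xs
  vertices≡xs = vertices-pairUp {G} xs even

length-vertices-even : {G : Graph} (M : List (V G × V G)) → length (vertices {G} M) % 2 ≡ 0
length-vertices-even [] = refl
length-vertices-even {G} (_ ∷ M) = length-vertices-even {G} M

diagonal : (Fin t → V (ProdK t n)) → V (ProdK t n)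
diagonal e i = e i i

undominated-vertex : 2 ≤ t → (∀ i → t < n i) → (e : Fin t → V (ProdK t n)) →
  (j : Fin t) → diagonal e ≡ e j → ∃[ u ] ∀ k → ¬ (u ≡ e k ⊎ Adj (ProdK t n) u (e k))
undominated-vertex {t} {n} 2≤t t<n e j diagonal≡eⱼ = u , undominated
  where
  fresh : Fin (n j)
  fresh = inject≤ (proj₁ (missing-value (λ k → toℕ (e k j)))) (t<n j)

  fresh-new : ∀ k → e k j ≢ fresh
  fresh-new k eq = proj₂ (missing-value (λ k → toℕ (e k j))) k
    (trans (cong toℕ eq) (toℕ-inject≤ _ (t<n j)))

  u : V (ProdK t n)
  u i with i ≟ j
  ... | yes refl = fresh
  ... | no _ = e i i

  uⱼ≡fresh : u j ≡ fresh
  uⱼ≡fresh with j ≟ j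
  ... | yes refl = refl
  ... | no j≢j = contradiction refl j≢j

  uᵢ≡eᵢᵢ : ∀ {i} → i ≢ j → u i ≡ e i i
  uᵢ≡eᵢᵢ {i} i≢j with i ≟ j
  ... | yes i≡j = contradiction i≡j i≢j
  ... | no _ = refl

  undominated : ∀ k → ¬ (u ≡ e k ⊎ Adj (ProdK t n) u (e k))
  undominated k (inj₁ u≡eₖ) = fresh-new k (sym (trans (sym uⱼ≡fresh) (cong-app u≡eₖ j)))
  undominated k (inj₂ adjacent) with k ≟ j
  ... | no k≢j = adjacent k (uᵢ≡eᵢᵢ k≢j)
  ... | yes refl =
    let i , i≢j = other-index 2≤t j in
    adjacent i (trans (uᵢ≡eᵢᵢ i≢j) (cong-app diagonal≡eⱼ i))

no-dominating-family : 2 ≤ t → (∀ i → t < n i) → (e : Fin t → V (ProdK t n)) →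
  ¬ (∀ v → ∃[ k ] (v ≡ e k ⊎ Adj (ProdK t n) v (e k)))
no-dominating-family 2≤t t<n e dom with dom (diagonal e)
... | k , inj₂ adjacent = adjacent k refl
... | j , inj₁ diagonal≡eⱼ =
  let u , undominated = undominated-vertex 2≤t t<n e j diagonal≡eⱼ
      k , u-dominated = dom u
  in undominated k u-dominated

dominating⇒t<length : 2 ≤ t → (∀ i → t < n i) →
  (D : List (V (ProdK t n))) → Dominates (ProdK t n) (_∈ D) → t < length D
dominating⇒t<length {t} {n} 2≤t t<n D dom with t <? length D
... | yes t<|D| = t<|D|
... | no t≮|D| = contradiction dom-by-e (no-dominating-family 2≤t t<n e)
  where
  e-covers : Σ (Fin t → V (ProdK t n)) λ e → ∀ {x} → x ∈ D → ∃[ i ] e i ≡ x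
  e-covers = padded-enumeration (λ i → fromℕ< (t<n i)) D (≤-pred (≰⇒> t≮|D|))
  e : Fin t → V (ProdK t n)
  e = proj₁ e-covers
  dom-by-e : ∀ v → ∃[ k ] (v ≡ e k ⊎ Adj (ProdK t n) v (e k))
  dom-by-e v with dom v
  ... | d , d∈D , v~d with proj₂ e-covers d∈D
  ...   | k , refl = k , v~d

pairedDominating⇒t<length : 2 ≤ t → (∀ i → t < n i) →
  ∀ M → PairedDominating (ProdK t n) M → t < length (vertices {ProdK t n} M)
pairedDominating⇒t<length 2≤t t<n M pd =
  dominating⇒t<length 2≤t t<n _ (PairedDominating.dominating pd)

constant : (∀ i → t < n i) → Fin (suc t) → V (ProdK t n)
constant t<n y i = inject≤ y (t<n i)

constant-adjacent : (t<n : ∀ i → t < n i) → ∀ {x y} → x ≢ y →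
  Adj (ProdK t n) (constant t<n x) (constant t<n y)
constant-adjacent t<n {x} {y} x≢y i eq = x≢y (inject≤-injective _ _ x y eq)

constant-injective : 0 < t → (t<n : ∀ i → t < n i) → ∀ {x y} →
  constant t<n x ≡ constant t<n y → x ≡ y
constant-injective (s≤s z≤n) t<n {x} {y} eq = inject≤-injective _ _ x y (cong-app eq Fin.zero)

adjacent-to-constant : (t<n : ∀ i → t < n i) → ∀ v → ∃[ y ] Adj (ProdK t n) v (constant t<n y)
adjacent-to-constant t<n v =
  let y , y-missed = missing-value (λ i → toℕ (v i)) in
  y , λ i eq → y-missed i (trans (cong toℕ eq) (toℕ-inject≤ y (t<n i)))

constants : (∀ i → t < n i) → List (V (ProdK t n))
constants {t} t<n = map (constant t<n) (allFin (suc t))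

constants-dominate : (t<n : ∀ i → t < n i) (xs : List (V (ProdK t n))) →
  (∀ y → constant t<n y ∈ xs) → Dominates (ProdK t n) (_∈ xs)
constants-dominate t<n xs ∈xs v =
  let y , adjacent = adjacent-to-constant t<n v in constant t<n y , ∈xs y , inj₂ adjacent

constants-unique : 0 < t → (t<n : ∀ i → t < n i) → Unique (constants t<n)
constants-unique {t} 0<t t<n = Uniqueₚ.map⁺ (constant-injective 0<t t<n) (Uniqueₚ.allFin⁺ (suc t))

constants-pairwise-adjacent : (t<n : ∀ i → t < n i) → AllPairs (Adj (ProdK t n)) (constants t<n)
constants-pairwise-adjacent {t} t<n =
  AllPairsₚ.map⁺ (AllPairs.map (constant-adjacent t<n) (Uniqueₚ.allFin⁺ (suc t)))

length-constants : (t<n : ∀ i → t < n i) → length (constants t<n) ≡ suc t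
length-constants {t} t<n =
  trans (length-map (constant t<n) (allFin (suc t))) (length-tabulate (λ y → y))

constant∈constants : (t<n : ∀ i → t < n i) (y : Fin (suc t)) → constant t<n y ∈ constants t<n
constant∈constants t<n y = ∈-map⁺ (constant t<n) (∈-allFin y)

nonconstant-neighbour-of-constant₀ : 2 ≤ t → (t<n : ∀ i → t < n i) →
  ∃[ w ] (Adj (ProdK t n) w (constant t<n Fin.zero) × ∀ y → w ≢ constant t<n y)
nonconstant-neighbour-of-constant₀ {suc (suc t)} {n} (s≤s (s≤s z≤n)) t<n =
  w , w~constant₀ , w-nonconstant
  where
  one two : Fin (suc (suc (suc t)))
  one = Fin.suc Fin.zero
  two = Fin.suc (Fin.suc Fin.zero)

  w : V (ProdK (suc (suc t)) n)
  w Fin.zero = constant t<n one Fin.zero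
  w (Fin.suc i) = constant t<n two (Fin.suc i)

  w~constant₀ : Adj (ProdK (suc (suc t)) n) w (constant t<n Fin.zero)
  w~constant₀ Fin.zero = constant-adjacent t<n (λ ()) Fin.zero
  w~constant₀ (Fin.suc i) = constant-adjacent t<n (λ ()) (Fin.suc i)

  w-nonconstant : ∀ y → w ≢ constant t<n y
  w-nonconstant y eq = one≢two (trans one≡y (sym two≡y))
    where
    one≡y : one ≡ y
    one≡y = inject≤-injective _ _ one y (cong-app eq Fin.zero)
    two≡y : two ≡ y
    two≡y = inject≤-injective _ _ two y (cong-app eq (Fin.suc Fin.zero))
    one≢two : one ≢ two
    one≢two ()

pairedDomNumber-odd : 2 ≤ t → (∀ i → t < n i) → t % 2 ≡ 1 → PairedDomNumber (ProdK t n) (t + 1)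
pairedDomNumber-odd {t} {n} 2≤t t<n t-odd = (pairUp cs , paired , size) , lower-bound
  where
  open ≡-Reasoning

  cs : List (V (ProdK t n))
  cs = constants t<n

  cs-even : length cs % 2 ≡ 0
  cs-even = subst (λ k → k % 2 ≡ 0) (sym (length-constants t<n)) (odd⇒suc-even t t-odd)

  paired : PairedDominating (ProdK t n) (pairUp cs)
  paired = pairUp-pairedDominating cs cs-even
    (constants-unique (≤-trans (s≤s z≤n) 2≤t) t<n)
    (pairUp⁺ (constants-pairwise-adjacent t<n))
    (constants-dominate t<n cs (constant∈constants t<n))

  size : length (vertices {ProdK t n} (pairUp cs)) ≡ t + 1
  size = begin
    length (vertices {ProdK t n} (pairUp cs))
      ≡⟨ cong length (vertices-pairUp {ProdK t n} cs cs-even) ⟩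
    length cs
      ≡⟨ length-constants t<n ⟩
    suc t
      ≡⟨ +-comm 1 t ⟩
    t + 1 ∎

  lower-bound : ∀ M → PairedDominating (ProdK t n) M → t + 1 ≤ length (vertices {ProdK t n} M)
  lower-bound M pd = subst (_≤ length (vertices {ProdK t n} M)) (+-comm 1 t)
    (pairedDominating⇒t<length 2≤t t<n M pd)

pairedDomNumber-even : 2 ≤ t → (∀ i → t < n i) → t % 2 ≡ 0 → PairedDomNumber (ProdK t n) (t + 2)
pairedDomNumber-even {t} {n} 2≤t t<n t-even = (pairUp xs , paired , size) , lower-bound
  where
  open ≡-Reasoning

  w : V (ProdK t n)
  w = proj₁ (nonconstant-neighbour-of-constant₀ 2≤t t<n)

  w~constant₀ : Adj (ProdK t n) w (constant t<n Fin.zero)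
  w~constant₀ = proj₁ (proj₂ (nonconstant-neighbour-of-constant₀ 2≤t t<n))

  w-nonconstant : ∀ y → w ≢ constant t<n y
  w-nonconstant = proj₂ (proj₂ (nonconstant-neighbour-of-constant₀ 2≤t t<n))

  xs : List (V (ProdK t n))
  xs = w ∷ constants t<n

  xs-even : length xs % 2 ≡ 0
  xs-even = subst (λ k → suc k % 2 ≡ 0) (sym (length-constants t<n)) t-even

  paired : PairedDominating (ProdK t n) (pairUp xs)
  paired = pairUp-pairedDominating xs xs-even
    (Allₚ.map⁺ (Allₚ.tabulate⁺ w-nonconstant) ∷ constants-unique (≤-trans (s≤s z≤n) 2≤t) t<n)
    (w~constant₀ ∷ pairUp⁺ (AllPairs.tail (constants-pairwise-adjacent t<n)))
    (constants-dominate t<n xs (there ∘ constant∈constants t<n))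

  size : length (vertices {ProdK t n} (pairUp xs)) ≡ t + 2
  size = begin
    length (vertices {ProdK t n} (pairUp xs))
      ≡⟨ cong length (vertices-pairUp {ProdK t n} xs xs-even) ⟩
    suc (length (constants t<n))
      ≡⟨ cong suc (length-constants t<n) ⟩
    suc (suc t)
      ≡⟨ +-comm 2 t ⟩
    t + 2 ∎

  lower-bound : ∀ M → PairedDominating (ProdK t n) M → t + 2 ≤ length (vertices {ProdK t n} M)
  lower-bound M pd = subst (_≤ length (vertices {ProdK t n} M)) (+-comm 2 t)
    (even<even⇒1+m<n t-even (length-vertices-even {ProdK t n} M)
      (pairedDominating⇒t<length 2≤t t<n M pd))

lemma3 : (t : ℕ) → 3 ≤ t → (n : Fin t → ℕ) → ((i : Fin t) → suc t ≤ n i) →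
    (t % 2 ≡ 1 → PairedDomNumber (ProdK t n) (t + 1))
    × (t % 2 ≡ 0 → PairedDomNumber (ProdK t n) (t + 2))
lemma3 t 3≤t n t<n = pairedDomNumber-odd 2≤t t<n , pairedDomNumber-even 2≤t t<n
  where
  2≤t : 2 ≤ t
  2≤t = ≤-trans (n≤1+n 2) 3≤t
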